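{- Let $g \geq 1$ be an integer. Every connected graph $G$ of order $n$, minimum degree $\delta \geq 3$ and girth at least $2g+1$ has a connected $2g$-step dominating set of size at most $\left(\frac{2g+1}{C_{\delta,g}}\right) n - 2g$, where $C_{\delta,g} = \frac{\delta(\delta-1)^g - 2}{\delta - 2}$.
   Context: All graphs are finite, simple and undirected. The girth of a graph is the length of a shortest cycle. For $D \subseteq V(G)$, $d_G(v,D) = \min_{x \in D} d_G(v,x)$. A set $D \subseteq V(G)$ is an $l$-step dominating set of $G$ if every vertex of $G$ is at distance at most $l$ from $D$; it is a connected $l$-step dominating set if moreover the induced subgraph $G[D]$ is connected. -}

module Defs where

open import Data.Nat using (ℕ; zero; suc; _+_; _*_; _∸_; _^_; _≤_)
open import Data.Bool using (Bool; true; false; if_then_else_)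
open import Data.Fin using (Fin; zero; suc; inject₁; fromℕ)
open import Data.Fin.Subset using (Subset; _∈_)
open import Data.List using (List; map; allFin)
open import Data.Nat.ListAction using (sum)
open import Data.Empty using (⊥)
open import Data.Product using (Σ; _×_; ∃; ∃-syntax)
open import Relation.Binary.PropositionalEquality using (_≡_)
open import Relation.Nullary using (¬_)
open import Function.Definitions using (Injective)

record Graph (n : ℕ) : Set where
  field
    adj    : Fin n → Fin n → Bool
    symm   : ∀ u v → adj u v ≡ adj v u
    irrefl : ∀ u → adj u u ≡ false
open Graph public

Adj : ∀ {n} → Graph n → Fin n → Fin n → Set
Adj G u v = adj G u v ≡ true

deg : ∀ {n} → Graph n → Fin n → ℕ
deg {n} G u = sum (map (λ v → if adj G u v then 1 else 0) (allFin n))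

MinDegree : ∀ {n} → Graph n → ℕ → Set
MinDegree G δ = (∀ v → δ ≤ deg G v) × ∃[ v ] (deg G v ≡ δ)

data Walk {n} (G : Graph n) : Fin n → Fin n → ℕ → Set where
  here : ∀ {u} → Walk G u u 0
  step : ∀ {u w v k} → Adj G u w → Walk G w v k → Walk G u v (suc k)

data WalkIn {n} (G : Graph n) (D : Subset n) : Fin n → Fin n → Set where
  here : ∀ {u} → u ∈ D → WalkIn G D u u
  step : ∀ {u w v} → u ∈ D → Adj G u w → WalkIn G D w v → WalkIn G D u v

Connected : ∀ {n} → Graph n → Set
Connected G = ∀ u v → ∃[ k ] Walk G u v k

InducedConnected : ∀ {n} → Graph n → Subset n → Set
InducedConnected G D = ∀ u v → u ∈ D → v ∈ D → WalkIn G D u v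

-- d_G(v,D) ≤ l for every v  (distance = minimum walk length)
StepDominating : ∀ {n} → Graph n → ℕ → Subset n → Set
StepDominating G l D = ∀ v → ∃[ x ] (x ∈ D × ∃[ k ] (k ≤ l × Walk G v x k))

ConnectedStepDominating : ∀ {n} → Graph n → ℕ → Subset n → Set
ConnectedStepDominating G l D = StepDominating G l D × InducedConnected G D

HasCycle : ∀ {n} → Graph n → ℕ → Set
HasCycle G zero = ⊥
HasCycle {n} G (suc m) =
  3 ≤ suc m × Σ (Fin (suc m) → Fin n) (λ c →
    Injective _≡_ _≡_ c ×
    (∀ (i : Fin m) → Adj G (c (inject₁ i)) (c (suc i))) ×
    Adj G (c (fromℕ m)) (c zero))

-- girth ≥ r  (every cycle has length ≥ r; acyclic graphs have infinite girth)
GirthAtLeast : ∀ {n} → Graph n → ℕ → Set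
GirthAtLeast G r = ∀ k → HasCycle G k → r ≤ k

module Submission where

-- Grow a connected set D from a vertex r: while some vertex v is at distance > 2g from D, walk
-- from v towards r up to a vertex w at distance > 2g from D whose successor is within distance 2g
-- of D, and add to D a walk of length ≤ 2g + 1 from w into D. Every round adds at most 2g + 1
-- vertices and a new centre w at distance > 2g from the earlier centres (which lie in D), so
-- |D| + 2g ≤ (2g + 1) K for K centres. Since the girth exceeds 2g, distinct non-backtracking
-- walks of length ≤ g from a vertex end at distinct vertices, so the ball of radius g around a
-- centre has at least 1 + δ ∑_{i<g} (δ - 1)^i = (δ (δ - 1)^g - 2) / (δ - 2) vertices; the balls
-- around the centres are pairwise disjoint, hence K times this number is at most n.

open import Defs
open import Data.Nat using (ℕ; zero; suc; _+_; _*_; _∸_; _^_; _≤_; _<_; z≤n; s≤s; s≤s⁻¹)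
open import Data.Nat.Properties
open import Algebra.Properties.CommutativeSemigroup +-commutativeSemigroup using (xy∙z≈xz∙y)
open import Data.Nat.Induction using (<-wellFounded)
open import Data.Nat.ListAction using (sum)
open import Data.Nat.Tactic.RingSolver using (solve-∀)
open import Induction.WellFounded using (Acc; acc)
open import Data.Bool using (true; false; if_then_else_)
import Data.Bool.Properties as Bool
open import Data.Empty using (⊥-elim)
open import Data.Unit using (⊤; tt)
open import Data.Product using (Σ; _×_; ∃; ∃-syntax; _,_; proj₁; proj₂)
open import Data.Sum using (_⊎_; inj₁; inj₂)
open import Data.Fin using (Fin; zero; suc; inject₁; fromℕ)
open import Data.Fin.Properties using (any?; all?; ¬∀⟶∃¬; injective⇒≤) renaming (_≟_ to _≟ᶠ_)
open import Data.Vec using ([]; _∷_)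
open import Data.Fin.Subset using (Subset; ∣_∣; _∪_; ⁅_⁆; _⊆_; inside; outside) renaming (_∈_ to _∈ˢ_)
open import Data.Fin.Subset.Properties using (_∈?_; x∈⁅x⁆; x∈⁅y⁆⇒x≡y; ∣⁅x⁆∣≡1; q⊆p∪q; x∈p∪q⁻; x∈p∪q⁺; ∣p∣≤∣x∷p∣)
open import Data.List using (List; []; _∷_; _++_; [_]; length; map; concatMap; filter; allFin; lookup; reverse; _ʳ++_)
open import Data.List.Properties
  using (≡-dec; ∷-injective; length-++; length-map; ʳ++-defn; length-ʳ++; ++-assoc; filter-all; length-++-≤ˡ; length-++-≤ʳ)
open import Data.List.Membership.Propositional using (_∈_)
open import Data.List.Membership.Propositional.Properties using (∈-∃++; ∈-map⁻; ∈-lookup)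
open import Data.List.Membership.DecPropositional using () renaming (_∈?_ to _∈?ˡ_)
open import Data.List.Relation.Unary.Any using (here; there)
open import Data.List.Relation.Unary.Any.Properties using (reverse⁺)
open import Data.List.Relation.Unary.All as All using (All; []; _∷_)
import Data.List.Relation.Unary.All.Properties as All
open import Data.List.Relation.Unary.AllPairs as AllPairs using (AllPairs; []; _∷_)
import Data.List.Relation.Unary.AllPairs.Properties as AllPairs
open import Data.List.Relation.Unary.Unique.Propositional using (Unique)
import Data.List.Relation.Unary.Unique.Propositional.Properties as Unique
open import Data.List.Relation.Binary.Disjoint.Propositional using (Disjoint)
open import Data.List.Relation.Unary.Linked as Linked using (Linked; []; [-]; _∷_)
open import Relation.Nullary using (¬_; Dec; yes; no; ¬?)
open import Relation.Nullary.Decidable using (_×-dec_)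
open import Relation.Unary using (Decidable)
open import Relation.Binary.Definitions using (DecidableEquality)
open import Relation.Binary.PropositionalEquality using (_≡_; _≢_; refl; sym; trans; cong; cong₂; subst; module ≡-Reasoning)

module _ {A : Set} where

  Repeats : List A → Set
  Repeats xs = ∃ λ as → ∃ λ v → ∃ λ bs → ∃ λ cs → xs ≡ as ++ (v ∷ bs ++ [ v ]) ++ cs

  unique⊎repeats : DecidableEquality A → (xs : List A) → Unique xs ⊎ Repeats xs
  unique⊎repeats _≟_ [] = inj₁ []
  unique⊎repeats _≟_ (x ∷ xs) with _∈?ˡ_ _≟_ x xs | unique⊎repeats _≟_ xs
  ... | yes x∈xs | _ with ys , zs , refl ← ∈-∃++ x∈xs =
    inj₂ ([] , x , ys , zs , cong (x ∷_) (sym (++-assoc ys [ x ] zs)))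
  ... | no x∉xs | inj₁ u = inj₁ (All.¬Any⇒All¬ xs x∉xs ∷ u)
  ... | no _ | inj₂ (as , v , bs , cs , eq) = inj₂ (x ∷ as , v , bs , cs , cong (x ∷_) eq)

  Repeats-++ : ∀ {xs ys v} → v ∈ xs → v ∈ ys → Repeats (xs ++ ys)
  Repeats-++ {v = v} v∈xs v∈ys with as , bs , refl ← ∈-∃++ v∈xs | cs , ds , refl ← ∈-∃++ v∈ys =
    as , v , bs ++ cs , ds , trans (++-assoc as (v ∷ bs) (cs ++ v ∷ ds)) (cong (λ zs → as ++ v ∷ zs) (begin
      bs ++ cs ++ v ∷ ds       ≡⟨ ++-assoc bs cs (v ∷ ds) ⟨
      (bs ++ cs) ++ [ v ] ++ ds ≡⟨ ++-assoc (bs ++ cs) [ v ] ds ⟨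
      ((bs ++ cs) ++ [ v ]) ++ ds ∎))
    where open ≡-Reasoning

  length-infix : ∀ (as ys ds : List A) → length ys ≤ length (as ++ ys ++ ds)
  length-infix as ys ds = ≤-trans (length-++-≤ˡ ys) (length-++-≤ʳ (ys ++ ds) {as})

  length-loop : ∀ v (bs : List A) → length (v ∷ bs ++ [ v ]) ≡ suc (suc (length bs))
  length-loop v bs = cong suc (trans (length-++ bs) (+-comm (length bs) 1))

  length-filter-≢ : (_≟_ : DecidableEquality A) → ∀ y {xs} → Unique xs →
                    length xs ≤ suc (length (filter (λ x → ¬? (x ≟ y)) xs))
  length-filter-≢ _≟_ y [] = z≤n
  length-filter-≢ _≟_ y {x ∷ xs} (x∉xs ∷ u) with x ≟ y
  ... | yes refl = s≤s (≤-reflexive (sym (cong length (filter-all (λ z → ¬? (z ≟ x)) xs≢x))))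
    where
      xs≢x : All (_≢ x) xs
      xs≢x = All.map (λ x≢z z≡x → x≢z (sym z≡x)) x∉xs
  ... | no _ = s≤s (length-filter-≢ _≟_ y u)

  lookup-injective : ∀ {xs : List A} → Unique xs → ∀ {i j} → lookup xs i ≡ lookup xs j → i ≡ j
  lookup-injective {_ ∷ _}  _           {zero}  {zero}  _ = refl
  lookup-injective {_ ∷ xs} (x∉xs ∷ _)  {zero}  {suc j} e = ⊥-elim (All.lookup x∉xs (∈-lookup j) e)
  lookup-injective {_ ∷ xs} (x∉xs ∷ _)  {suc i} {zero}  e = ⊥-elim (All.lookup x∉xs (∈-lookup i) (sym e))
  lookup-injective {_ ∷ _}  (_ ∷ u)     {suc i} {suc j} e = cong suc (lookup-injective u e)

unique-map-injectiveOn : ∀ {A B : Set} {P : A → Set} {f : A → B} {xs} →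
                         (∀ {x y} → P x → P y → f x ≡ f y → x ≡ y) → All P xs → Unique xs → Unique (map f xs)
unique-map-injectiveOn inj [] [] = []
unique-map-injectiveOn inj (px ∷ pxs) (x∉xs ∷ u) =
  All.map⁺ (All.zipWith (λ (py , x≢y) fx≡fy → x≢y (inj px py fx≡fy)) (pxs , x∉xs)) ∷ unique-map-injectiveOn inj pxs u

unique⇒length≤ : ∀ {n} {xs : List (Fin n)} → Unique xs → length xs ≤ n
unique⇒length≤ u = injective⇒≤ (lookup-injective u)

length-concatMap-≥ : ∀ {A B : Set} {k} (f : A → List B) xs →
                     All (λ x → k ≤ length (f x)) xs → length xs * k ≤ length (concatMap f xs)
length-concatMap-≥ f [] [] = z≤n
length-concatMap-≥ f (x ∷ xs) (k≤ ∷ k≤s) =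
  ≤-trans (+-mono-≤ k≤ (length-concatMap-≥ f xs k≤s)) (≤-reflexive (sym (length-++ (f x))))

module _ {A : Set} {R : A → A → Set} where

  Linked-++⁻ˡ : ∀ xs {ys} → Linked R (xs ++ ys) → Linked R xs
  Linked-++⁻ˡ [] _ = []
  Linked-++⁻ˡ (x ∷ []) _ = [-]
  Linked-++⁻ˡ (x ∷ y ∷ xs) (r ∷ l) = r ∷ Linked-++⁻ˡ (y ∷ xs) l

  Linked-++⁻ʳ : ∀ xs {ys} → Linked R (xs ++ ys) → Linked R ys
  Linked-++⁻ʳ [] l = l
  Linked-++⁻ʳ (x ∷ xs) l = Linked-++⁻ʳ xs (Linked.tail l)

  Linked-lookup : ∀ {x} xs {ys} → Linked R (x ∷ xs ++ ys) →
                  (i : Fin (length xs)) → R (lookup (x ∷ xs) (inject₁ i)) (lookup xs i)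
  Linked-lookup (y ∷ xs) (r ∷ _) zero = r
  Linked-lookup (y ∷ xs) (_ ∷ l) (suc i) = Linked-lookup xs l i

  Linked-last : ∀ {x} xs {y ys} → Linked R (x ∷ xs ++ y ∷ ys) →
                R (lookup (x ∷ xs) (fromℕ (length xs))) y
  Linked-last [] (r ∷ _) = r
  Linked-last (z ∷ xs) (_ ∷ l) = Linked-last xs l

  Linked-ʳ++ : (∀ {x y} → R x y → R y x) → ∀ x xs ys →
               Linked R (x ∷ xs) → Linked R (x ∷ ys) → Linked R (xs ʳ++ x ∷ ys)
  Linked-ʳ++ sym-R x [] ys _ l = l
  Linked-ʳ++ sym-R x (y ∷ xs) ys (r ∷ l₁) l₂ = Linked-ʳ++ sym-R y xs (x ∷ ys) l₁ (sym-R r ∷ l₂)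

module _ {A : Set} where

  data NonBacktracking : List A → Set where
    []    : NonBacktracking []
    [-]   : ∀ {x} → NonBacktracking (x ∷ [])
    [-,-] : ∀ {x y} → NonBacktracking (x ∷ y ∷ [])
    _∷_   : ∀ {x y z zs} → x ≢ z → NonBacktracking (y ∷ z ∷ zs) → NonBacktracking (x ∷ y ∷ z ∷ zs)

  NonBacktracking-tail : ∀ {x xs} → NonBacktracking (x ∷ xs) → NonBacktracking xs
  NonBacktracking-tail [-] = []
  NonBacktracking-tail [-,-] = [-]
  NonBacktracking-tail (_ ∷ nb) = nb

  NonBacktracking-++⁻ˡ : ∀ xs {ys} → NonBacktracking (xs ++ ys) → NonBacktracking xs
  NonBacktracking-++⁻ˡ [] _ = []
  NonBacktracking-++⁻ˡ (x ∷ []) _ = [-]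
  NonBacktracking-++⁻ˡ (x ∷ y ∷ []) _ = [-,-]
  NonBacktracking-++⁻ˡ (x ∷ y ∷ z ∷ xs) (x≢z ∷ nb) = x≢z ∷ NonBacktracking-++⁻ˡ (y ∷ z ∷ xs) nb

  NonBacktracking-++⁻ʳ : ∀ xs {ys} → NonBacktracking (xs ++ ys) → NonBacktracking ys
  NonBacktracking-++⁻ʳ [] nb = nb
  NonBacktracking-++⁻ʳ (x ∷ xs) nb = NonBacktracking-++⁻ʳ xs (NonBacktracking-tail nb)

  HeadsDiffer : List A → List A → Set
  HeadsDiffer (x ∷ _) (y ∷ _) = x ≢ y
  HeadsDiffer _ _ = ⊤

  NonBacktracking-ʳ++ : ∀ x xs ys → NonBacktracking (x ∷ xs) → NonBacktracking (x ∷ ys) →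
                        HeadsDiffer xs ys → NonBacktracking (xs ʳ++ x ∷ ys)
  NonBacktracking-ʳ++ x [] ys _ nb₂ _ = nb₂
  NonBacktracking-ʳ++ x (y ∷ xs) ys nb₁ nb₂ y≢ys =
    NonBacktracking-ʳ++ y xs (x ∷ ys) (NonBacktracking-tail nb₁) (cons ys nb₂ y≢ys) (turn xs nb₁)
    where
      cons : ∀ ys → NonBacktracking (x ∷ ys) → HeadsDiffer (y ∷ xs) ys → NonBacktracking (y ∷ x ∷ ys)
      cons [] _ _ = [-,-]
      cons (_ ∷ _) nb y≢z = y≢z ∷ nb
      turn : ∀ xs → NonBacktracking (x ∷ y ∷ xs) → HeadsDiffer xs (x ∷ ys)
      turn [] _ = tt
      turn (_ ∷ _) (x≢w ∷ _) = λ w≡x → x≢w (sym w≡x)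

∣p∪q∣≤∣p∣+∣q∣ : ∀ {n} (p q : Subset n) → ∣ p ∪ q ∣ ≤ ∣ p ∣ + ∣ q ∣
∣p∪q∣≤∣p∣+∣q∣ [] [] = z≤n
∣p∪q∣≤∣p∣+∣q∣ (inside ∷ p) (y ∷ q) = s≤s (≤-trans (∣p∪q∣≤∣p∣+∣q∣ p q) (+-monoʳ-≤ ∣ p ∣ (∣p∣≤∣x∷p∣ y q)))
∣p∪q∣≤∣p∣+∣q∣ (outside ∷ p) (inside ∷ q) = ≤-trans (s≤s (∣p∪q∣≤∣p∣+∣q∣ p q)) (≤-reflexive (sym (+-suc ∣ p ∣ ∣ q ∣)))
∣p∪q∣≤∣p∣+∣q∣ (outside ∷ p) (outside ∷ q) = ∣p∪q∣≤∣p∣+∣q∣ p q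

geomSum : ℕ → ℕ → ℕ
geomSum q zero = 0
geomSum q (suc k) = geomSum q k + q ^ k

moore : ℕ → ℕ → ℕ
moore δ k = 1 + δ * geomSum (δ ∸ 1) k

geomSum-identity : ∀ e k → e * geomSum (suc e) k + 1 ≡ suc e ^ k
geomSum-identity e zero = cong (_+ 1) (*-zeroʳ e)
geomSum-identity e (suc k) = begin
  e * (geomSum (suc e) k + suc e ^ k) + 1    ≡⟨ distrib e (geomSum (suc e) k) (suc e ^ k) ⟩
  (e * geomSum (suc e) k + 1) + e * suc e ^ k ≡⟨ cong (_+ e * suc e ^ k) (geomSum-identity e k) ⟩
  suc e ^ suc k                              ∎
  where
    open ≡-Reasoning
    distrib : ∀ e s p → e * (s + p) + 1 ≡ (e * s + 1) + e * p
    distrib = solve-∀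

moore-identity : ∀ e k → moore (2 + e) k * e ≡ (2 + e) * (1 + e) ^ k ∸ 2
moore-identity e k = begin
  moore (2 + e) k * e                         ≡⟨ m+n∸n≡m (moore (2 + e) k * e) 2 ⟨
  moore (2 + e) k * e + 2 ∸ 2                 ≡⟨ cong (_∸ 2) (expand e (geomSum (1 + e) k)) ⟨
  (2 + e) * (e * geomSum (1 + e) k + 1) ∸ 2   ≡⟨ cong (λ z → (2 + e) * z ∸ 2) (geomSum-identity e k) ⟩
  (2 + e) * (1 + e) ^ k ∸ 2                   ∎
  where
    open ≡-Reasoning
    expand : ∀ e s → (2 + e) * (e * s + 1) ≡ (1 + (2 + e) * s) * e + 2
    expand = solve-∀

module _ {n} (G : Graph n) where

  Adj-sym : ∀ {u v} → Adj G u v → Adj G v u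
  Adj-sym {u} {v} e = trans (symm G v u) e

  Adj-irrefl : ∀ {v} → ¬ Adj G v v
  Adj-irrefl {v} e with () ← trans (sym e) (irrefl G v)

  Adj? : ∀ u → Decidable (Adj G u)
  Adj? u v = adj G u v Bool.≟ true

  walk-++ : ∀ {u v w k m} → Walk G u v k → Walk G v w m → Walk G u w (k + m)
  walk-++ here q = q
  walk-++ (step e p) q = step e (walk-++ p q)

  walk-reverse : ∀ {u v k} → Walk G u v k → Walk G v u k
  walk-reverse here = here
  walk-reverse {k = suc k} (step e p) =
    subst (Walk G _ _) (+-comm k 1) (walk-++ (walk-reverse p) (step (Adj-sym e) here))

  walkIn-head : ∀ {D u v} → WalkIn G D u v → u ∈ˢ D
  walkIn-head (here u∈D) = u∈D
  walkIn-head (step u∈D _ _) = u∈D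

  walkIn-++ : ∀ {D u v w} → WalkIn G D u v → WalkIn G D v w → WalkIn G D u w
  walkIn-++ (here _) q = q
  walkIn-++ (step u∈D e p) q = step u∈D e (walkIn-++ p q)

  walkIn-reverse : ∀ {D u v} → WalkIn G D u v → WalkIn G D v u
  walkIn-reverse (here u∈D) = here u∈D
  walkIn-reverse (step u∈D e p) = walkIn-++ (walkIn-reverse p) (step (walkIn-head p) (Adj-sym e) (here u∈D))

  walkIn-mono : ∀ {D E u v} → D ⊆ E → WalkIn G D u v → WalkIn G E u v
  walkIn-mono D⊆E (here u∈D) = here (D⊆E u∈D)
  walkIn-mono D⊆E (step u∈D e p) = step (D⊆E u∈D) e (walkIn-mono D⊆E p)

  Far : ℕ → Fin n → Fin n → Set
  Far l u v = ∀ m → m ≤ l → ¬ Walk G u v m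

  neighbours : Fin n → List (Fin n)
  neighbours u = filter (Adj? u) (allFin n)

  deg≡length-neighbours : ∀ u → deg G u ≡ length (neighbours u)
  deg≡length-neighbours u = count (allFin n)
    where
      count : ∀ vs → sum (map (λ v → if adj G u v then 1 else 0) vs) ≡ length (filter (Adj? u) vs)
      count [] = refl
      count (v ∷ vs) with adj G u v
      ... | true = cong suc (count vs)
      ... | false = count vs

  unique-loop⇒cycle : ∀ {v bs} → Unique (v ∷ bs) →
                      Linked (Adj G) (v ∷ bs ++ [ v ]) → NonBacktracking (v ∷ bs ++ [ v ]) →
                      HasCycle G (suc (length bs))
  unique-loop⇒cycle {v} {bs} u L nb =
    length≥3 bs L nb , lookup (v ∷ bs) , lookup-injective u , Linked-lookup bs L , Linked-last bs L
    where
      length≥3 : ∀ bs → Linked (Adj G) (v ∷ bs ++ [ v ]) → NonBacktracking (v ∷ bs ++ [ v ]) → 3 ≤ suc (length bs)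
      length≥3 [] (e ∷ _) _ = ⊥-elim (Adj-irrefl e)
      length≥3 (_ ∷ []) _ (v≢v ∷ _) = ⊥-elim (v≢v refl)
      length≥3 (_ ∷ _ ∷ _) _ _ = s≤s (s≤s (s≤s z≤n))

  repeats⇒short-cycle : ∀ {W} → Acc _<_ (length W) → Repeats W → Linked (Adj G) W → NonBacktracking W →
                        ∃[ m ] (HasCycle G m × m < length W)
  repeats⇒short-cycle (acc shorter) (as , v , bs , cs , refl) L nb = cycle-in-loop (unique⊎repeats _≟ᶠ_ (v ∷ bs))
    where
      loop : List (Fin n)
      loop = v ∷ bs ++ [ v ]
      L′ : Linked (Adj G) loop
      L′ = Linked-++⁻ˡ loop (Linked-++⁻ʳ as L)
      nb′ : NonBacktracking loop
      nb′ = NonBacktracking-++⁻ˡ loop (NonBacktracking-++⁻ʳ as nb)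
      loop≤W : suc (suc (length bs)) ≤ length (as ++ loop ++ cs)
      loop≤W = subst (_≤ length (as ++ loop ++ cs)) (length-loop v bs) (length-infix as loop cs)
      cycle-in-loop : Unique (v ∷ bs) ⊎ Repeats (v ∷ bs) → ∃[ m ] (HasCycle G m × m < length (as ++ loop ++ cs))
      cycle-in-loop (inj₁ u) = suc (length bs) , unique-loop⇒cycle u L′ nb′ , loop≤W
      cycle-in-loop (inj₂ rep) =
        let m , cycle , m<bs = repeats⇒short-cycle (shorter loop≤W) rep
                                 (Linked-++⁻ˡ (v ∷ bs) L′) (NonBacktracking-++⁻ˡ (v ∷ bs) nb′)
        in m , cycle , <-trans m<bs loop≤W

  girth<length-repeats : ∀ {r W} → GirthAtLeast G r → Repeats W → Linked (Adj G) W → NonBacktracking W → r < length W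
  girth<length-repeats gir rep L nb =
    let m , cycle , m<W = repeats⇒short-cycle (<-wellFounded _) rep L nb in ≤-trans (s≤s (gir m cycle)) m<W

  -- A non-backtracking walk from c to x; xs lists its earlier vertices, latest first.
  data NBWalk (c : Fin n) : Fin n → List (Fin n) → Set where
    start  : NBWalk c c []
    extend : ∀ {x xs w} → NBWalk c x xs → Adj G x w → HeadsDiffer [ w ] xs → NBWalk c w (x ∷ xs)

  NBWalk-linked : ∀ {c x xs} → NBWalk c x xs → Linked (Adj G) (x ∷ xs)
  NBWalk-linked start = [-]
  NBWalk-linked (extend P e _) = Adj-sym e ∷ NBWalk-linked P

  NBWalk-nonBacktracking : ∀ {c x xs} → NBWalk c x xs → NonBacktracking (x ∷ xs)
  NBWalk-nonBacktracking start = [-]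
  NBWalk-nonBacktracking (extend {xs = []} P _ _) = [-,-]
  NBWalk-nonBacktracking (extend {xs = _ ∷ _} P _ w≢y) = w≢y ∷ NBWalk-nonBacktracking P

  NBWalk-walk : ∀ {c x xs} → NBWalk c x xs → Walk G x c (length xs)
  NBWalk-walk start = here
  NBWalk-walk (extend P e _) = step (Adj-sym e) (NBWalk-walk P)

  NBWalk-origin : ∀ {c x xs} → NBWalk c x xs → (xs ≡ [] × x ≡ c) ⊎ c ∈ xs
  NBWalk-origin start = inj₁ (refl , refl)
  NBWalk-origin (extend P _ _) with NBWalk-origin P
  ... | inj₁ (refl , refl) = inj₂ (here refl)
  ... | inj₂ c∈xs = inj₂ (there c∈xs)

  girth≤length-NBWalks-divergent : ∀ {r c x xs ys} → GirthAtLeast G r → NBWalk c x xs → NBWalk c x ys → xs ≢ ys →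
                        HeadsDiffer xs ys → r ≤ length xs + length ys
  girth≤length-NBWalks-divergent {r} {c} {x} {xs} {ys} gir P Q xs≢ys heads =
    s≤s⁻¹ (subst (r <_) (trans (length-ʳ++ xs) (+-suc (length xs) (length ys)))
      (girth<length-repeats gir (subst Repeats (sym (ʳ++-defn xs)) repeats)
        (Linked-ʳ++ Adj-sym x xs ys (NBWalk-linked P) (NBWalk-linked Q))
        (NonBacktracking-ʳ++ x xs ys (NBWalk-nonBacktracking P) (NBWalk-nonBacktracking Q) heads)))
    where
      repeats : Repeats (reverse xs ++ x ∷ ys)
      repeats with NBWalk-origin P | NBWalk-origin Q
      ... | inj₁ (refl , refl) | inj₁ (refl , _) = ⊥-elim (xs≢ys refl)
      ... | inj₁ (refl , refl) | inj₂ c∈ys = Repeats-++ {xs = [ c ]} (here refl) c∈ys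
      ... | inj₂ c∈xs | inj₁ (refl , refl) = Repeats-++ (reverse⁺ c∈xs) (here refl)
      ... | inj₂ c∈xs | inj₂ c∈ys = Repeats-++ (reverse⁺ c∈xs) (there c∈ys)

  girth≤length-NBWalks : ∀ {r c x xs ys} → GirthAtLeast G r → NBWalk c x xs → NBWalk c x ys → xs ≢ ys →
                         r ≤ length xs + length ys
  girth≤length-NBWalks gir P@start Q xs≢ys = girth≤length-NBWalks-divergent gir P Q xs≢ys tt
  girth≤length-NBWalks gir P@(extend _ _ _) Q@start xs≢ys = girth≤length-NBWalks-divergent gir P Q xs≢ys tt
  girth≤length-NBWalks gir P@(extend {x = y} {xs} P′ _ _) Q@(extend {x = z} {ys} Q′ _ _) xs≢ys with y ≟ᶠ z
  ... | yes refl = ≤-trans (girth≤length-NBWalks gir P′ Q′ (λ xs≡ys → xs≢ys (cong (y ∷_) xs≡ys)))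
                     (+-mono-≤ (n≤1+n (length xs)) (n≤1+n (length ys)))
  ... | no y≢z = girth≤length-NBWalks-divergent gir P Q xs≢ys y≢z

  successors : Fin n → List (Fin n) → List (Fin n)
  successors x [] = neighbours x
  successors x (y ∷ _) = filter (λ w → ¬? (w ≟ᶠ y)) (neighbours x)

  successors-valid : ∀ x xs → All (λ w → Adj G x w × HeadsDiffer [ w ] xs) (successors x xs)
  successors-valid x [] = All.map (_, tt) (All.all-filter (Adj? x) (allFin n))
  successors-valid x (y ∷ _) =
    All.zip ( All.filter⁺ (λ w → ¬? (w ≟ᶠ y)) (All.all-filter (Adj? x) (allFin n))
            , All.all-filter (λ w → ¬? (w ≟ᶠ y)) (neighbours x))

  successors-unique : ∀ x xs → Unique (successors x xs)
  successors-unique x [] = Unique.filter⁺ (Adj? x) (Unique.allFin⁺ n)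
  successors-unique x (y ∷ _) = Unique.filter⁺ (λ w → ¬? (w ≟ᶠ y)) (successors-unique x [])

  deg∸1≤length-successors : ∀ x xs → deg G x ∸ 1 ≤ length (successors x xs)
  deg∸1≤length-successors x [] = ≤-trans (m∸n≤m (deg G x) 1) (≤-reflexive (deg≡length-neighbours x))
  deg∸1≤length-successors x (y ∷ _) =
    ∸-monoˡ-≤ 1 (≤-trans (≤-reflexive (deg≡length-neighbours x)) (length-filter-≢ _≟ᶠ_ y (successors-unique x [])))

  extensions : Fin n × List (Fin n) → List (Fin n × List (Fin n))
  extensions (x , xs) = map (_, x ∷ xs) (successors x xs)

  layer : Fin n → ℕ → List (Fin n × List (Fin n))
  layer c zero = [ c , [] ]
  layer c (suc k) = concatMap extensions (layer c k)

  walksUpTo : Fin n → ℕ → List (Fin n × List (Fin n))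
  walksUpTo c zero = layer c zero
  walksUpTo c (suc k) = walksUpTo c k ++ layer c (suc k)

  NBWalkOfLength : Fin n → ℕ → Fin n × List (Fin n) → Set
  NBWalkOfLength c k (x , xs) = NBWalk c x xs × length xs ≡ k

  ShortNBWalk : Fin n → ℕ → Fin n × List (Fin n) → Set
  ShortNBWalk c k (x , xs) = NBWalk c x xs × length xs ≤ k

  layer-walks : ∀ c k → All (NBWalkOfLength c k) (layer c k)
  layer-walks c zero = (start , refl) ∷ []
  layer-walks c (suc k) = All.concat⁺ (All.map⁺ (All.map extend-all (layer-walks c k)))
    where
      extend-all : ∀ {p} → NBWalkOfLength c k p → All (NBWalkOfLength c (suc k)) (extensions p)
      extend-all {x , xs} (P , refl) = All.map⁺ (All.map (λ (e , w≢y) → extend P e w≢y , refl) (successors-valid x xs))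

  walksUpTo-walks : ∀ c k → All (ShortNBWalk c k) (walksUpTo c k)
  walksUpTo-walks c zero = (start , z≤n) ∷ []
  walksUpTo-walks c (suc k) =
    All.++⁺ (All.map (λ (P , ≤k) → P , m≤n⇒m≤1+n ≤k) (walksUpTo-walks c k))
            (All.map (λ (P , ≡k) → P , ≤-reflexive ≡k) (layer-walks c (suc k)))

  layer-unique : ∀ c k → Unique (layer c k)
  layer-unique c zero = [] ∷ []
  layer-unique c (suc k) =
    Unique.concat⁺ (All.map⁺ (All.universal extensions-unique (layer c k)))
                   (AllPairs.map⁺ (AllPairs.map extensions-disjoint (layer-unique c k)))
    where
      extensions-unique : ∀ p → Unique (extensions p)
      extensions-unique (x , xs) = Unique.map⁺ (cong proj₁) (successors-unique x xs)
      extensions-disjoint : ∀ {p q} → p ≢ q → Disjoint (extensions p) (extensions q)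
      extensions-disjoint p≢q (v∈p , v∈q) with _ , _ , refl ← ∈-map⁻ _ v∈p | _ , _ , eq ← ∈-map⁻ _ v∈q =
        p≢q (let x≡y , xs≡ys = ∷-injective (cong proj₂ eq) in cong₂ _,_ x≡y xs≡ys)

  walksUpTo-unique : ∀ c k → Unique (walksUpTo c k)
  walksUpTo-unique c zero = [] ∷ []
  walksUpTo-unique c (suc k) = Unique.++⁺ (walksUpTo-unique c k) (layer-unique c (suc k)) shorter-than-layer
    where
      shorter-than-layer : Disjoint (walksUpTo c k) (layer c (suc k))
      shorter-than-layer (p∈walks , p∈layer) =
        <-irrefl (proj₂ (All.lookup (layer-walks c (suc k)) p∈layer))
                 (s≤s (proj₂ (All.lookup (walksUpTo-walks c k) p∈walks)))

  ball : Fin n → ℕ → List (Fin n)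
  ball c k = map proj₁ (walksUpTo c k)

  ball-unique : ∀ {c k} → GirthAtLeast G (2 * k + 1) → Unique (ball c k)
  ball-unique {c} {k} gir = unique-map-injectiveOn same-end (walksUpTo-walks c k) (walksUpTo-unique c k)
    where
      same-end : ∀ {p q} → ShortNBWalk c k p → ShortNBWalk c k q → proj₁ p ≡ proj₁ q → p ≡ q
      same-end {x , xs} {_ , ys} (P , xs≤k) (Q , ys≤k) refl with ≡-dec _≟ᶠ_ xs ys
      ... | yes refl = refl
      ... | no xs≢ys = ⊥-elim (<-irrefl refl (begin-strict
        k + k               ≡⟨ cong (k +_) (+-identityʳ k) ⟨
        2 * k               <⟨ ≤-reflexive (+-comm 1 (2 * k)) ⟩
        2 * k + 1           ≤⟨ girth≤length-NBWalks gir P Q xs≢ys ⟩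
        length xs + length ys ≤⟨ +-mono-≤ xs≤k ys≤k ⟩
        k + k               ∎))
        where open ≤-Reasoning

  ∈-ball⇒walk : ∀ {b c k} → b ∈ ball c k → ∃[ m ] (m ≤ k × Walk G b c m)
  ∈-ball⇒walk {c = c} {k} b∈ball with (_ , xs) , p∈walks , refl ← ∈-map⁻ proj₁ b∈ball
    with P , xs≤k ← All.lookup (walksUpTo-walks c k) p∈walks = length xs , xs≤k , NBWalk-walk P

  balls-disjoint : ∀ {c c′ k} → Far (2 * k) c c′ → Disjoint (ball c k) (ball c′ k)
  balls-disjoint {c} {c′} {k} far (b∈ball , b∈ball′)
    with m , m≤k , q ← ∈-ball⇒walk {c = c} {k} b∈ball | m′ , m′≤k , q′ ← ∈-ball⇒walk {c = c′} {k} b∈ball′ =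
    far (m + m′) (+-mono-≤ m≤k (≤-trans m′≤k (m≤m+n k 0))) (walk-++ (walk-reverse q) q′)

  module _ {δ} (minDeg : ∀ v → δ ≤ deg G v) where

    layer-length : ∀ c k → δ * (δ ∸ 1) ^ k ≤ length (layer c (suc k))
    layer-length c zero = begin
      δ * 1                      ≡⟨ *-identityʳ δ ⟩
      δ                          ≤⟨ minDeg c ⟩
      deg G c                    ≡⟨ deg≡length-neighbours c ⟩
      length (neighbours c)      ≡⟨ length-map (_, [ c ]) (neighbours c) ⟨
      length (extensions (c , [])) ≤⟨ length-++-≤ˡ (extensions (c , [])) ⟩
      length (layer c 1)         ∎
      where open ≤-Reasoning
    layer-length c (suc k) = begin
      δ * ((δ ∸ 1) * (δ ∸ 1) ^ k)                 ≡⟨ cong (δ *_) (*-comm (δ ∸ 1) ((δ ∸ 1) ^ k)) ⟩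
      δ * ((δ ∸ 1) ^ k * (δ ∸ 1))                 ≡⟨ *-assoc δ ((δ ∸ 1) ^ k) (δ ∸ 1) ⟨
      δ * (δ ∸ 1) ^ k * (δ ∸ 1)                   ≤⟨ *-monoˡ-≤ (δ ∸ 1) (layer-length c k) ⟩
      length (layer c (suc k)) * (δ ∸ 1)          ≤⟨ length-concatMap-≥ extensions (layer c (suc k))
                                                       (All.map extensions-length (layer-walks c (suc k))) ⟩
      length (layer c (suc (suc k)))              ∎
      where
        open ≤-Reasoning
        extensions-length : ∀ {p} → NBWalkOfLength c (suc k) p → δ ∸ 1 ≤ length (extensions p)
        extensions-length {x , xs} _ = ≤-trans (∸-monoˡ-≤ 1 (minDeg x))
          (≤-trans (deg∸1≤length-successors x xs) (≤-reflexive (sym (length-map (_, x ∷ xs) (successors x xs)))))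

    walksUpTo-length : ∀ c k → moore δ k ≤ length (walksUpTo c k)
    walksUpTo-length c zero = ≤-reflexive (cong suc (*-zeroʳ δ))
    walksUpTo-length c (suc k) = begin
      1 + δ * (geomSum (δ ∸ 1) k + (δ ∸ 1) ^ k)  ≡⟨ cong suc (*-distribˡ-+ δ (geomSum (δ ∸ 1) k) ((δ ∸ 1) ^ k)) ⟩
      moore δ k + δ * (δ ∸ 1) ^ k                ≤⟨ +-mono-≤ (walksUpTo-length c k) (layer-length c k) ⟩
      length (walksUpTo c k) + length (layer c (suc k)) ≡⟨ length-++ (walksUpTo c k) ⟨
      length (walksUpTo c (suc k))               ∎
      where open ≤-Reasoning

    ball-length : ∀ c k → moore δ k ≤ length (ball c k)
    ball-length c k = ≤-trans (walksUpTo-length c k) (≤-reflexive (sym (length-map proj₁ (walksUpTo c k))))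

    centres-packing : ∀ {k cs} → GirthAtLeast G (2 * k + 1) → AllPairs (Far (2 * k)) cs → length cs * moore δ k ≤ n
    centres-packing {k} {cs} gir far = ≤-trans
      (length-concatMap-≥ (λ c → ball c k) cs (All.universal (λ c → ball-length c k) cs))
      (unique⇒length≤ (Unique.concat⁺ (All.map⁺ (All.universal (λ c → ball-unique {c} {k} gir) cs))
                                       (AllPairs.map⁺ (AllPairs.map (balls-disjoint {k = k}) far))))

  Dominated : ℕ → Subset n → Fin n → Set
  Dominated l D v = ∃[ x ] (x ∈ˢ D × ∃[ k ] (k ≤ l × Walk G v x k))

  dominated? : ∀ l D v → Dec (Dominated l D v)
  dominated? zero D v with v ∈? D
  ... | yes v∈D = yes (v , v∈D , 0 , z≤n , here)
  ... | no v∉D = no λ { (_ , x∈D , zero , _ , here) → v∉D x∈D }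
  dominated? (suc l) D v with v ∈? D | any? (λ w → Adj? v w ×-dec dominated? l D w)
  ... | yes v∈D | _ = yes (v , v∈D , 0 , z≤n , here)
  ... | no _ | yes (w , e , x , x∈D , k , k≤l , q) = yes (x , x∈D , suc k , s≤s k≤l , step e q)
  ... | no v∉D | no none = no λ
    { (_ , x∈D , zero , _ , here) → v∉D x∈D
    ; (x , x∈D , suc k , s≤s k≤l , step e q) → none (_ , e , x , x∈D , k , k≤l , q) }

  undominated-frontier : ∀ {l D u x m} → Walk G u x m → x ∈ˢ D → ¬ Dominated l D u →
                         ∃[ w ] (¬ Dominated l D w × Dominated (suc l) D w)
  undominated-frontier here x∈D u-undom = ⊥-elim (u-undom (_ , x∈D , 0 , z≤n , here))
  undominated-frontier {l} {D} {u} (step {w = u′} e q) x∈D u-undom with dominated? l D u′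
  ... | yes (y , y∈D , k , k≤l , q′) = u , u-undom , y , y∈D , suc k , s≤s k≤l , step e q′
  ... | no u′-undom = undominated-frontier q x∈D u′-undom

  addWalk : ∀ {u v m} → Walk G u v m → Subset n → Subset n
  addWalk here D = D
  addWalk (step {u} _ q) D = ⁅ u ⁆ ∪ addWalk q D

  addWalk-size : ∀ {u v m} (q : Walk G u v m) D → ∣ addWalk q D ∣ ≤ ∣ D ∣ + m
  addWalk-size here D = m≤m+n ∣ D ∣ 0
  addWalk-size {m = suc m} (step {u} _ q) D = begin
    ∣ ⁅ u ⁆ ∪ addWalk q D ∣       ≤⟨ ∣p∪q∣≤∣p∣+∣q∣ ⁅ u ⁆ (addWalk q D) ⟩
    ∣ ⁅ u ⁆ ∣ + ∣ addWalk q D ∣   ≡⟨ cong (_+ ∣ addWalk q D ∣) (∣⁅x⁆∣≡1 u) ⟩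
    suc ∣ addWalk q D ∣           ≤⟨ s≤s (addWalk-size q D) ⟩
    suc (∣ D ∣ + m)               ≡⟨ +-suc ∣ D ∣ m ⟨
    ∣ D ∣ + suc m                 ∎
    where open ≤-Reasoning

  addWalk-⊇ : ∀ {u v m} (q : Walk G u v m) D → D ⊆ addWalk q D
  addWalk-⊇ here D x∈D = x∈D
  addWalk-⊇ (step {u} _ q) D x∈D = q⊆p∪q ⁅ u ⁆ (addWalk q D) (addWalk-⊇ q D x∈D)

  addWalk-start : ∀ {u v m} (q : Walk G u v m) {D} → v ∈ˢ D → u ∈ˢ addWalk q D
  addWalk-start here v∈D = v∈D
  addWalk-start (step {u} _ q) _ = x∈p∪q⁺ (inj₁ (x∈⁅x⁆ u))

  Rooted : Subset n → Fin n → Set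
  Rooted D r = ∀ u → u ∈ˢ D → WalkIn G D u r

  addWalk-rooted : ∀ {u v m r} (q : Walk G u v m) {D} → v ∈ˢ D → Rooted D r → Rooted (addWalk q D) r
  addWalk-rooted here _ rooted = rooted
  addWalk-rooted (step {u} e q) {D} v∈D rooted x x∈D′ with x∈p∪q⁻ ⁅ u ⁆ (addWalk q D) x∈D′
  ... | inj₂ x∈E = walkIn-mono (q⊆p∪q ⁅ u ⁆ (addWalk q D)) (addWalk-rooted q v∈D rooted x x∈E)
  ... | inj₁ x∈⁅u⁆ with refl ← x∈⁅y⁆⇒x≡y u x∈⁅u⁆ =
    step x∈D′ e (walkIn-mono (q⊆p∪q ⁅ u ⁆ (addWalk q D)) (addWalk-rooted q v∈D rooted _ (addWalk-start q v∈D)))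

  module Greedy (l : ℕ) (connected : Connected G) (r : Fin n) where

    record State : Set where
      field
        D : Subset n
        centres : List (Fin n)
        r∈D : r ∈ˢ D
        rooted : Rooted D r
        centres∈D : All (_∈ˢ D) centres
        centres-far : AllPairs (Far l) centres
        size : ∣ D ∣ + l ≤ (l + 1) * length centres
    open State

    initial : State
    initial = record
      { D = ⁅ r ⁆
      ; centres = [ r ]
      ; r∈D = x∈⁅x⁆ r
      ; rooted = λ { u u∈⁅r⁆ → subst (λ x → WalkIn G ⁅ r ⁆ x r) (sym (x∈⁅y⁆⇒x≡y r u∈⁅r⁆)) (here (x∈⁅x⁆ r)) }
      ; centres∈D = x∈⁅x⁆ r ∷ []
      ; centres-far = [] ∷ []
      ; size = ≤-reflexive (trans (cong (_+ l) (∣⁅x⁆∣≡1 r)) (trans (+-comm 1 l) (sym (*-identityʳ (l + 1)))))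
      }

    grow : (s : State) → ∀ v → ¬ Dominated l (D s) v → Σ State λ s′ → length (centres s′) ≡ suc (length (centres s))
    grow s v v-undom with _ , walk ← connected v r
      with w , w-undom , y , y∈D , m , m≤1+l , q ← undominated-frontier walk (r∈D s) v-undom =
      record
        { D = D′
        ; centres = w ∷ centres s
        ; r∈D = addWalk-⊇ q (D s) (r∈D s)
        ; rooted = addWalk-rooted q y∈D (rooted s)
        ; centres∈D = addWalk-start q y∈D ∷ All.map (addWalk-⊇ q (D s)) (centres∈D s)
        ; centres-far = All.map (λ c∈D k k≤l walk → w-undom (_ , c∈D , k , k≤l , walk)) (centres∈D s) ∷ centres-far s
        ; size = size′
        } , refl
      where
        D′ : Subset n
        D′ = addWalk q (D s)
        size′ : ∣ D′ ∣ + l ≤ (l + 1) * suc (length (centres s))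
        size′ = begin
          ∣ D′ ∣ + l                                  ≤⟨ +-monoˡ-≤ l (addWalk-size q (D s)) ⟩
          ∣ D s ∣ + m + l                             ≡⟨ xy∙z≈xz∙y ∣ D s ∣ m l ⟩
          ∣ D s ∣ + l + m                             ≤⟨ +-mono-≤ (size s) (≤-trans m≤1+l (≤-reflexive (+-comm 1 l))) ⟩
          (l + 1) * length (centres s) + (l + 1)      ≡⟨ +-comm ((l + 1) * length (centres s)) (l + 1) ⟩
          (l + 1) + (l + 1) * length (centres s)      ≡⟨ *-suc (l + 1) (length (centres s)) ⟨
          (l + 1) * suc (length (centres s))          ∎
          where open ≤-Reasoning

    far⇒unique : ∀ {cs} → AllPairs (Far l) cs → Unique cs
    far⇒unique = AllPairs.map (λ far u≡v → far 0 z≤n (subst (λ v → Walk G _ v 0) u≡v here))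

    run : ∀ fuel (s : State) → n < length (centres s) + fuel → Σ State λ s → StepDominating G l (D s)
    run zero s n< = ⊥-elim (<⇒≱ n< (≤-trans (≤-reflexive (+-identityʳ _)) (unique⇒length≤ (far⇒unique (centres-far s)))))
    run (suc fuel) s n< with all? (dominated? l (D s))
    ... | yes dominating = s , dominating
    ... | no ¬dominating with v , v-undom ← ¬∀⟶∃¬ n _ (dominated? l (D s)) ¬dominating
      with s′ , grown ← grow s v v-undom =
      run fuel s′ (subst (n <_) (trans (+-suc (length (centres s)) fuel) (cong (_+ fuel) (sym grown))) n<)

  dominating-set-with-far-centres :
    ∀ l → Connected G → Fin n →
    ∃[ D ] ∃[ cs ] (ConnectedStepDominating G l D × AllPairs (Far l) cs × ∣ D ∣ + l ≤ (l + 1) * length cs)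
  dominating-set-with-far-centres l connected r =
    let s , dominating = run n initial ≤-refl
    in D s , centres s , (dominating , induced-connected (rooted s)) , centres-far s , size s
    where
      open Greedy l connected r
      open State
      induced-connected : ∀ {D} → Rooted D r → InducedConnected G D
      induced-connected rooted u v u∈D v∈D = walkIn-++ (rooted u u∈D) (walkIn-reverse (rooted v v∈D))

lemma4 : (g : ℕ) → 1 ≤ g → (n : ℕ) → (G : Graph n) → (δ : ℕ) →
    Connected G → MinDegree G δ → 3 ≤ δ → GirthAtLeast G (2 * g + 1) →
    ∃[ D ] (ConnectedStepDominating G (2 * g) D ×
      (∣ D ∣ + 2 * g) * (δ * (δ ∸ 1) ^ g ∸ 2) ≤ (2 * g + 1) * (δ ∸ 2) * n)
lemma4 g _ n G δ@(suc (suc (suc d))) connected (minDeg , r , _) (s≤s (s≤s (s≤s _))) gir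
  with D , cs , dominating , far , size ← dominating-set-with-far-centres G (2 * g) connected r =
  D , dominating , (begin
    (∣ D ∣ + 2 * g) * (δ * (δ ∸ 1) ^ g ∸ 2)         ≡⟨ cong ((∣ D ∣ + 2 * g) *_) (moore-identity (suc d) g) ⟨
    (∣ D ∣ + 2 * g) * (moore δ g * suc d)           ≤⟨ *-monoˡ-≤ (moore δ g * suc d) size ⟩
    (2 * g + 1) * length cs * (moore δ g * suc d)   ≡⟨ rearrange (2 * g + 1) (length cs) (moore δ g) (suc d) ⟩
    (2 * g + 1) * suc d * (length cs * moore δ g)   ≤⟨ *-monoʳ-≤ ((2 * g + 1) * suc d) packing ⟩
    (2 * g + 1) * suc d * n                         ∎)
  where
    open ≤-Reasoning
    packing : length cs * moore δ g ≤ n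
    packing = centres-packing G minDeg {g} gir far
    rearrange : ∀ a c m e → a * c * (m * e) ≡ a * e * (c * m)
    rearrange = solve-∀
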